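{- Let $G=(V,E)$ be a graph and let $G'=(V',E')$ be obtained from $G$ by an inclusive vertex split of a vertex $u\in V$ into two vertices $v,w\in V'$. If $\mathcal{P}'$ is a Star-decomposition of $G'$, then there exists a Star-decomposition $\mathcal{P}$ of $G$ with $\mathrm{wgt}(\mathcal{P})\le \mathrm{wgt}(\mathcal{P}')$.
   Context: All graphs are finite, simple and undirected. An inclusive vertex split of $u$ removes $u$ and adds two new vertices $v,w$ with $N(v)\cup N(w)=N(u)$ ($N(v)$ and $N(w)$ may intersect); no other adjacencies change. A star is a graph with a single central vertex adjacent to all other vertices. A Star-decomposition of a graph $H$ is a set $\mathcal{P}=\{H_1,\dots,H_l\}$ of subgraphs of $H$, each isomorphic to a star, whose edge sets partition $E(H)$; its weight is $\mathrm{wgt}(\mathcal{P})=\sum_{x\in V(H)}|\{i: x\in V(H_i)\}|$. -}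

module Defs where

open import Data.Nat using (ℕ; suc)
open import Data.Bool using (Bool; true; false; _∨_)
open import Data.Fin using (Fin)
open import Data.Fin.Subset using (Subset; _∈_; _∉_; ∣_∣)
open import Data.List using (List; length; lookup; map)
open import Data.Nat.ListAction using (sum)
open import Data.Product using (Σ; ∃; _×_)
open import Data.Sum using (_⊎_)
open import Relation.Binary.PropositionalEquality using (_≡_; _≢_)

record Graph (n : ℕ) : Set where
  field
    adj : Fin n → Fin n → Bool
    sym : ∀ x y → adj x y ≡ adj y x
    irr : ∀ x → adj x x ≡ false
open Graph public

-- The map f identifies the vertices of G':
-- v and w are sent to u, and f is a bijection from V(G') ∖ {v,w} onto V(G) ∖ {u}.
record IsInclusiveSplit {n : ℕ} (G : Graph n) (u : Fin n)
                        (G' : Graph (suc n)) (v w : Fin (suc n)) : Set where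
  field
    f        : Fin (suc n) → Fin n
    v≢w      : v ≢ w
    f-v      : f v ≡ u
    f-w      : f w ≡ u
    f-u      : ∀ x → f x ≡ u → x ≡ v ⊎ x ≡ w
    f-inj    : ∀ x y → f x ≢ u → f x ≡ f y → x ≡ y
    f-surj   : ∀ z → ∃ λ x → f x ≡ z
    adj-rest : ∀ x y → x ≢ v → x ≢ w → y ≢ v → y ≢ w →
               adj G' x y ≡ adj G (f x) (f y)
    adj-vw   : adj G' v w ≡ false
    adj-split : ∀ y → y ≢ v → y ≢ w →
               adj G u (f y) ≡ (adj G' v y ∨ adj G' w y)

-- A star subgraph of G: a centre together with a set of leaves,
-- every leaf adjacent (in G) to the centre.  Its vertex set is {centre} ∪ leaves,
-- its edge set is {centre x : x ∈ leaves}.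
record Star {n : ℕ} (G : Graph n) : Set where
  field
    centre  : Fin n
    leaves  : Subset n
    centre∉ : centre ∉ leaves
    edges⊆  : ∀ x → x ∈ leaves → adj G centre x ≡ true
open Star public

HasEdge : {n : ℕ} {G : Graph n} → Star G → Fin n → Fin n → Set
HasEdge s x y = (centre s ≡ x × y ∈ leaves s) ⊎ (centre s ≡ y × x ∈ leaves s)

-- A Star-decomposition of G: a family of star subgraphs whose edge sets
-- partition E(G): every edge lies in exactly one of them.
-- (Stars' edges are edges of G by construction.)
IsStarDecomposition : {n : ℕ} (G : Graph n) → List (Star G) → Set
IsStarDecomposition G P =
  ∀ x y → adj G x y ≡ true →
    Σ (Fin (length P)) λ i → HasEdge (lookup P i) x y ×
      (∀ j → HasEdge (lookup P j) x y → j ≡ i)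

-- Weight: Σ_x |{i : x ∈ V(H_i)}| = Σ_i |V(H_i)| = Σ_i (1 + |leaves_i|).
wgt : {n : ℕ} {G : Graph n} → List (Star G) → ℕ
wgt P = sum (map (λ s → suc ∣ leaves s ∣) P)

{-# OPTIONS --safe #-}
-- Merging v and w back into u is a graph homomorphism f : G' → G through which every
-- edge of G lifts, because N(v) ∪ N(w) = N(u).  So the f-images of the stars of P' are
-- stars of G covering every edge of G, and images of leaf sets are no larger.  These
-- image stars may share edges; deleting from each star the edges covered by the later
-- ones leaves a decomposition, again without increasing the weight.
module Submission where

open import Defs hiding (sym)
open import Data.Nat using (ℕ; suc; _+_; _≤_; z≤n; s≤s)
open import Data.Nat.Properties using (≤-trans; ≤-reflexive; +-suc; +-mono-≤; m≤n⇒m≤1+n)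
open import Data.Bool using (true; false; _∨_)
open import Data.Bool.Properties using (∨-zeroʳ)
open import Data.Fin using (Fin; zero; suc; _≟_)
open import Data.Fin.Subset using (Subset; inside; outside; _∈_; ∣_∣; _∩_; _∪_; ⁅_⁆; ⊥)
open import Data.Fin.Subset.Properties
  using (_∈?_; ∉⊥; ∣⊥∣≡0; x∈⁅x⁆; x∈⁅y⁆⇒x≡y; ∣⁅x⁆∣≡1; x∈p∩q⁺; x∈p∩q⁻; ∣p∩q∣≤∣p∣; x∈p∪q⁺; x∈p∪q⁻)
open import Data.List using (List; []; _∷_; lookup; map)
open import Data.List.Relation.Unary.Any as Any using (Any; here; there; index)
open import Data.List.Relation.Unary.Any.Properties using (lookup-index; map⁺)
open import Data.List.Membership.Propositional using (lose)
open import Data.List.Membership.Propositional.Properties using (∈-lookup)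
open import Data.Product using (Σ; ∃; ∃₂; _×_; _,_; proj₁; proj₂)
open import Data.Sum using (_⊎_; inj₁; inj₂)
open import Data.Vec as Vec using ([]; _∷_; tabulate)
open import Data.Vec.Properties using (lookup∘tabulate; lookup⇒[]=; []=⇒lookup)
open import Function using (_∘_)
open import Relation.Nullary using (¬_; Dec; yes; no; does; proof; contradiction)
open import Relation.Nullary.Reflects using (Reflects; invert)
open import Relation.Nullary.Decidable using (dec-true; ¬?; _×-dec_; _⊎-dec_)
open import Relation.Unary using (Pred; Decidable)
open import Relation.Binary.PropositionalEquality
  using (_≡_; _≢_; refl; sym; trans; cong; cong₂; subst)

module _ {n : ℕ} where

  toSubset : ∀ {ℓ} {P : Pred (Fin n) ℓ} → Decidable P → Subset n
  toSubset P? = tabulate (does ∘ P?)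

  module _ {ℓ} {P : Pred (Fin n) ℓ} (P? : Decidable P) {x : Fin n} where

    ∈-toSubset⁺ : P x → x ∈ toSubset P?
    ∈-toSubset⁺ px = lookup⇒[]= x _ (trans (lookup∘tabulate _ x) (dec-true (P? x) px))

    ∈-toSubset⁻ : x ∈ toSubset P? → P x
    ∈-toSubset⁻ x∈ = invert (subst (Reflects (P x)) does≡true (proof (P? x)))
      where
      does≡true : does (P? x) ≡ true
      does≡true = trans (sym (lookup∘tabulate _ x)) ([]=⇒lookup x∈)

∣p∪q∣≤∣p∣+∣q∣ : ∀ {n} (p q : Subset n) → ∣ p ∪ q ∣ ≤ ∣ p ∣ + ∣ q ∣
∣p∪q∣≤∣p∣+∣q∣ []            []            = z≤n
∣p∪q∣≤∣p∣+∣q∣ (outside ∷ p) (outside ∷ q) = ∣p∪q∣≤∣p∣+∣q∣ p q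
∣p∪q∣≤∣p∣+∣q∣ (outside ∷ p) (inside  ∷ q) =
  ≤-trans (s≤s (∣p∪q∣≤∣p∣+∣q∣ p q)) (≤-reflexive (sym (+-suc ∣ p ∣ ∣ q ∣)))
∣p∪q∣≤∣p∣+∣q∣ (inside  ∷ p) (outside ∷ q) = s≤s (∣p∪q∣≤∣p∣+∣q∣ p q)
∣p∪q∣≤∣p∣+∣q∣ (inside  ∷ p) (inside  ∷ q) =
  s≤s (≤-trans (m≤n⇒m≤1+n (∣p∪q∣≤∣p∣+∣q∣ p q)) (≤-reflexive (sym (+-suc ∣ p ∣ ∣ q ∣))))

image : ∀ {m n} → (Fin m → Fin n) → Subset m → Subset n
image f []            = ⊥
image f (outside ∷ p) = image (f ∘ suc) p
image f (inside  ∷ p) = ⁅ f zero ⁆ ∪ image (f ∘ suc) p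

∈-image⁺ : ∀ {m n} (f : Fin m → Fin n) {p : Subset m} {x : Fin m} → x ∈ p → f x ∈ image f p
∈-image⁺ f {inside  ∷ p} Vec.here        = x∈p∪q⁺ (inj₁ (x∈⁅x⁆ (f zero)))
∈-image⁺ f {outside ∷ p} (Vec.there x∈p) = ∈-image⁺ (f ∘ suc) x∈p
∈-image⁺ f {inside  ∷ p} (Vec.there x∈p) = x∈p∪q⁺ (inj₂ (∈-image⁺ (f ∘ suc) x∈p))

∈-image⁻ : ∀ {m n} (f : Fin m → Fin n) (p : Subset m) {y : Fin n} →
  y ∈ image f p → ∃ λ x → x ∈ p × f x ≡ y
∈-image⁻ f []            y∈ = contradiction y∈ ∉⊥
∈-image⁻ f (outside ∷ p) y∈ with ∈-image⁻ (f ∘ suc) p y∈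
... | x , x∈p , fx≡y = suc x , Vec.there x∈p , fx≡y
∈-image⁻ f (inside  ∷ p) y∈ with x∈p∪q⁻ ⁅ f zero ⁆ _ y∈
... | inj₁ y∈⁅f0⁆ = zero , Vec.here , sym (x∈⁅y⁆⇒x≡y (f zero) y∈⁅f0⁆)
... | inj₂ y∈img with ∈-image⁻ (f ∘ suc) p y∈img
...   | x , x∈p , fx≡y = suc x , Vec.there x∈p , fx≡y

∣image∣≤∣p∣ : ∀ {m n} (f : Fin m → Fin n) (p : Subset m) → ∣ image f p ∣ ≤ ∣ p ∣
∣image∣≤∣p∣ {n = n} f [] = ≤-reflexive (∣⊥∣≡0 n)
∣image∣≤∣p∣ f (outside ∷ p) = ∣image∣≤∣p∣ (f ∘ suc) p
∣image∣≤∣p∣ f (inside  ∷ p) =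
  ≤-trans (∣p∪q∣≤∣p∣+∣q∣ ⁅ f zero ⁆ _)
          (+-mono-≤ (≤-reflexive (∣⁅x⁆∣≡1 (f zero))) (∣image∣≤∣p∣ (f ∘ suc) p))

adj⇒≢ : ∀ {n} (G : Graph n) {x y : Fin n} → adj G x y ≡ true → x ≢ y
adj⇒≢ G {x} adj≡true refl with trans (sym adj≡true) (irr G x)
... | ()

module _ {n : ℕ} {G : Graph n} where

  HasEdge-sym : ∀ s {x y} → HasEdge {G = G} s x y → HasEdge s y x
  HasEdge-sym s (inj₁ edge) = inj₂ edge
  HasEdge-sym s (inj₂ edge) = inj₁ edge

  hasEdge? : (s : Star G) (x y : Fin n) → Dec (HasEdge s x y)
  hasEdge? s x y =
    ((centre s ≟ x) ×-dec (y ∈? leaves s)) ⊎-dec ((centre s ≟ y) ×-dec (x ∈? leaves s))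

  Covers : List (Star G) → Fin n → Fin n → Set
  Covers Q x y = Any (λ s → HasEdge s x y) Q

  covers? : (Q : List (Star G)) (x y : Fin n) → Dec (Covers Q x y)
  covers? Q x y = Any.any? (λ s → hasEdge? s x y) Q

  Covers-sym : ∀ {Q x y} → Covers Q x y → Covers Q y x
  Covers-sym = Any.map (λ {s} → HasEdge-sym s)

  Covers-lookup : ∀ Q i {x y} → HasEdge (lookup Q i) x y → Covers Q x y
  Covers-lookup Q i = lose (∈-lookup i)

  IsStarCover : List (Star G) → Set
  IsStarCover Q = ∀ x y → adj G x y ≡ true → Covers Q x y

  IsStarDecomposition⇒IsStarCover : ∀ {P} → IsStarDecomposition G P → IsStarCover P
  IsStarDecomposition⇒IsStarCover {P} decomposition x y adj≡true
    with decomposition x y adj≡true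
  ... | i , edge , _ = Covers-lookup P i edge

  trim : List (Star G) → Star G → Star G
  trim Q s = record
    { centre  = centre s
    ; leaves  = leaves s ∩ toSubset (¬? ∘ covers? Q (centre s))
    ; centre∉ = centre∉ s ∘ proj₁ ∘ x∈p∩q⁻ _ _
    ; edges⊆  = λ x → edges⊆ s x ∘ proj₁ ∘ x∈p∩q⁻ _ _
    }

  module _ (Q : List (Star G)) (s : Star G) {x y : Fin n} where

    HasEdge-trim⁺ : HasEdge s x y → ¬ Covers Q x y → HasEdge (trim Q s) x y
    HasEdge-trim⁺ (inj₁ (refl , y∈)) ¬covered =
      inj₁ (refl , x∈p∩q⁺ (y∈ , ∈-toSubset⁺ (¬? ∘ covers? Q x) ¬covered))
    HasEdge-trim⁺ (inj₂ (refl , x∈)) ¬covered =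
      inj₂ (refl , x∈p∩q⁺ (x∈ , ∈-toSubset⁺ (¬? ∘ covers? Q y) (¬covered ∘ Covers-sym)))

    HasEdge-trim⁻ : HasEdge (trim Q s) x y → HasEdge s x y × ¬ Covers Q x y
    HasEdge-trim⁻ (inj₁ (refl , y∈)) =
      let y∈s , y∈kept = x∈p∩q⁻ (leaves s) _ y∈
      in inj₁ (refl , y∈s) , ∈-toSubset⁻ (¬? ∘ covers? Q x) y∈kept
    HasEdge-trim⁻ (inj₂ (refl , x∈)) =
      let x∈s , x∈kept = x∈p∩q⁻ (leaves s) _ x∈
      in inj₂ (refl , x∈s) , ∈-toSubset⁻ (¬? ∘ covers? Q y) x∈kept ∘ Covers-sym

  disjointify : List (Star G) → List (Star G)
  disjointify []      = []
  disjointify (s ∷ Q) = trim Q s ∷ disjointify Q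

  Covers-disjointify⁺ : ∀ Q {x y} → Covers Q x y → Covers (disjointify Q) x y
  Covers-disjointify⁺ (s ∷ Q) {x} {y} (here edge) with covers? Q x y
  ... | yes covered = there (Covers-disjointify⁺ Q covered)
  ... | no ¬covered = here (HasEdge-trim⁺ Q s edge ¬covered)
  Covers-disjointify⁺ (s ∷ Q) (there covered) = there (Covers-disjointify⁺ Q covered)

  Covers-disjointify⁻ : ∀ Q {x y} → Covers (disjointify Q) x y → Covers Q x y
  Covers-disjointify⁻ (s ∷ Q) (here edge)     = here (proj₁ (HasEdge-trim⁻ Q s edge))
  Covers-disjointify⁻ (s ∷ Q) (there covered) = there (Covers-disjointify⁻ Q covered)

  trim-excludes : ∀ Q s j {x y} →
    HasEdge (trim Q s) x y → ¬ HasEdge (lookup (disjointify Q) j) x y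
  trim-excludes Q s j edge edgeⱼ =
    proj₂ (HasEdge-trim⁻ Q s edge) (Covers-disjointify⁻ Q (Covers-lookup (disjointify Q) j edgeⱼ))

  disjointify-unique : ∀ Q i j {x y} →
    HasEdge (lookup (disjointify Q) i) x y → HasEdge (lookup (disjointify Q) j) x y → i ≡ j
  disjointify-unique (s ∷ Q) zero    zero    _  _  = refl
  disjointify-unique (s ∷ Q) zero    (suc j) hᵢ hⱼ = contradiction hⱼ (trim-excludes Q s j hᵢ)
  disjointify-unique (s ∷ Q) (suc i) zero    hᵢ hⱼ = contradiction hᵢ (trim-excludes Q s i hⱼ)
  disjointify-unique (s ∷ Q) (suc i) (suc j) hᵢ hⱼ = cong suc (disjointify-unique Q i j hᵢ hⱼ)

  disjointify-isStarDecomposition : ∀ Q → IsStarCover Q → IsStarDecomposition G (disjointify Q)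
  disjointify-isStarDecomposition Q cover x y adj≡true =
    index covered , lookup-index covered ,
    λ j edge → disjointify-unique Q j (index covered) edge (lookup-index covered)
    where
    covered : Covers (disjointify Q) x y
    covered = Covers-disjointify⁺ Q (cover x y adj≡true)

  wgt-disjointify : ∀ Q → wgt (disjointify Q) ≤ wgt Q
  wgt-disjointify []      = z≤n
  wgt-disjointify (s ∷ Q) = +-mono-≤ (s≤s (∣p∩q∣≤∣p∣ (leaves s) _)) (wgt-disjointify Q)

module _ {m n : ℕ} (G' : Graph m) (G : Graph n) (f : Fin m → Fin n) where

  IsHomomorphism : Set
  IsHomomorphism = ∀ {x y} → adj G' x y ≡ true → adj G (f x) (f y) ≡ true

  LiftsEdges : Set
  LiftsEdges = ∀ {x y} → adj G x y ≡ true →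
    ∃₂ λ x' y' → f x' ≡ x × f y' ≡ y × adj G' x' y' ≡ true

module _ {m n : ℕ} {G' : Graph m} {G : Graph n} {f : Fin m → Fin n}
         (f-hom : IsHomomorphism G' G f) where

  mapStar : Star G' → Star G
  mapStar s = record
    { centre  = f (centre s)
    ; leaves  = image f (leaves s)
    -- no injectivity needed: f never identifies adjacent vertices, as G has no loops
    ; centre∉ = λ fc∈ → adj⇒≢ G (image-adjacent _ fc∈) refl
    ; edges⊆  = image-adjacent
    }
    where
    image-adjacent : ∀ y → y ∈ image f (leaves s) → adj G (f (centre s)) y ≡ true
    image-adjacent y y∈ with ∈-image⁻ f (leaves s) y∈
    ... | x , x∈ , refl = f-hom (edges⊆ s x x∈)

  HasEdge-mapStar : ∀ s {x y} → HasEdge s x y → HasEdge (mapStar s) (f x) (f y)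
  HasEdge-mapStar s (inj₁ (refl , y∈)) = inj₁ (refl , ∈-image⁺ f y∈)
  HasEdge-mapStar s (inj₂ (refl , x∈)) = inj₂ (refl , ∈-image⁺ f x∈)

  mapStar-isStarCover : LiftsEdges G' G f → ∀ {Q} → IsStarCover Q → IsStarCover (map mapStar Q)
  mapStar-isStarCover lift cover x y adj≡true with lift adj≡true
  ... | x' , y' , refl , refl , adj'≡true =
    map⁺ (Any.map (λ {s} → HasEdge-mapStar s) (cover x' y' adj'≡true))

  wgt-mapStar : ∀ Q → wgt (map mapStar Q) ≤ wgt Q
  wgt-mapStar []      = z≤n
  wgt-mapStar (s ∷ Q) = +-mono-≤ (s≤s (∣image∣≤∣p∣ f (leaves s))) (wgt-mapStar Q)

∨≡true⁻ : ∀ a b → a ∨ b ≡ true → a ≡ true ⊎ b ≡ true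
∨≡true⁻ true  _ _      = inj₁ refl
∨≡true⁻ false _ b≡true = inj₂ b≡true

module _ {n : ℕ} {G : Graph n} {u : Fin n} {G' : Graph (suc n)} {v w : Fin (suc n)}
         (split : IsInclusiveSplit G u G' v w) where
  open IsInclusiveSplit split

  private
    IsNew : Fin (suc n) → Set
    IsNew x = x ≡ v ⊎ x ≡ w

    isNew? : ∀ x → Dec (IsNew x)
    isNew? x = (x ≟ v) ⊎-dec (x ≟ w)

    f-new : ∀ {x} → IsNew x → f x ≡ u
    f-new (inj₁ refl) = f-v
    f-new (inj₂ refl) = f-w

    new-nonadjacent : ∀ {x y} → IsNew x → IsNew y → adj G' x y ≡ false
    new-nonadjacent (inj₁ refl) (inj₁ refl) = irr G' v
    new-nonadjacent (inj₁ refl) (inj₂ refl) = adj-vw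
    new-nonadjacent (inj₂ refl) (inj₁ refl) = trans (Graph.sym G' w v) adj-vw
    new-nonadjacent (inj₂ refl) (inj₂ refl) = irr G' w

    new-adjacent : ∀ {x y} → IsNew x → ¬ IsNew y → adj G' x y ≡ true → adj G (f x) (f y) ≡ true
    new-adjacent {x} {y} x-new y-old adj≡true =
      subst (λ z → adj G z (f y) ≡ true) (sym (f-new x-new))
        (trans (adj-split y (y-old ∘ inj₁) (y-old ∘ inj₂)) (either-adjacent x-new))
      where
      either-adjacent : IsNew x → adj G' v y ∨ adj G' w y ≡ true
      either-adjacent (inj₁ refl) = cong (_∨ adj G' w y) adj≡true
      either-adjacent (inj₂ refl) = trans (cong (adj G' v y ∨_) adj≡true) (∨-zeroʳ _)

  split-isHomomorphism : IsHomomorphism G' G f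
  split-isHomomorphism {x} {y} adj≡true with isNew? x | isNew? y
  ... | yes x-new | yes y-new =
    contradiction (trans (sym adj≡true) (new-nonadjacent x-new y-new)) λ ()
  ... | yes x-new | no y-old  = new-adjacent x-new y-old adj≡true
  ... | no x-old  | yes y-new =
    trans (Graph.sym G (f x) (f y)) (new-adjacent y-new x-old (trans (Graph.sym G' y x) adj≡true))
  ... | no x-old  | no y-old  =
    trans (sym (adj-rest x y (x-old ∘ inj₁) (x-old ∘ inj₂) (y-old ∘ inj₁) (y-old ∘ inj₂))) adj≡true

  private
    section : Fin n → Fin (suc n)
    section z = proj₁ (f-surj z)

    f-section : ∀ z → f (section z) ≡ z
    f-section z = proj₂ (f-surj z)

    section-old : ∀ {z} → z ≢ u → ¬ IsNew (section z)
    section-old {z} z≢u new = z≢u (trans (sym (f-section z)) (f-new new))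

    lift-from-u : ∀ {y} → y ≢ u → adj G u y ≡ true →
      ∃ λ x' → f x' ≡ u × adj G' x' (section y) ≡ true
    lift-from-u {y} y≢u adj≡true
      with ∨≡true⁻ (adj G' v (section y)) (adj G' w (section y))
             (trans (sym (adj-split (section y) (section-old y≢u ∘ inj₁) (section-old y≢u ∘ inj₂)))
                    (trans (cong (adj G u) (f-section y)) adj≡true))
    ... | inj₁ adj-v = v , f-v , adj-v
    ... | inj₂ adj-w = w , f-w , adj-w

  split-liftsEdges : LiftsEdges G' G f
  split-liftsEdges {x} {y} adj≡true with x ≟ u | y ≟ u
  ... | yes refl | yes refl = contradiction refl (adj⇒≢ G adj≡true)
  ... | yes refl | no y≢u with lift-from-u y≢u adj≡true
  ...   | x' , fx'≡u , adj'≡true = x' , section y , fx'≡u , f-section y , adj'≡true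
  split-liftsEdges {x} {y} adj≡true | no x≢u | yes refl
    with lift-from-u x≢u (trans (Graph.sym G u x) adj≡true)
  ...   | y' , fy'≡u , adj'≡true =
    section x , y' , f-section x , fy'≡u , trans (Graph.sym G' (section x) y') adj'≡true
  split-liftsEdges {x} {y} adj≡true | no x≢u | no y≢u =
    section x , section y , f-section x , f-section y ,
    trans (adj-rest (section x) (section y) (x-old ∘ inj₁) (x-old ∘ inj₂) (y-old ∘ inj₁) (y-old ∘ inj₂))
          (trans (cong₂ (adj G) (f-section x) (f-section y)) adj≡true)
    where
    x-old : ¬ IsNew (section x)
    x-old = section-old x≢u

    y-old : ¬ IsNew (section y)
    y-old = section-old y≢u

lemma2 : {n : ℕ} (G : Graph n) (u : Fin n) (G' : Graph (suc n)) (v w : Fin (suc n)) →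
    IsInclusiveSplit G u G' v w →
    (P' : List (Star G')) → IsStarDecomposition G' P' →
    Σ (List (Star G)) λ P → IsStarDecomposition G P × wgt P ≤ wgt P'
lemma2 G u G' v w split P' decomposition =
  disjointify Q , disjointify-isStarDecomposition Q cover , ≤-trans (wgt-disjointify Q) (wgt-mapStar hom P')
  where
  hom : IsHomomorphism G' G (IsInclusiveSplit.f split)
  hom = split-isHomomorphism split

  Q : List (Star G)
  Q = map (mapStar hom) P'

  cover : IsStarCover Q
  cover = mapStar-isStarCover hom (split-liftsEdges split) (IsStarDecomposition⇒IsStarCover decomposition)
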